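{- Let $G$ be a graph on $n$ vertices with maximum subgraph density $\rho$, and let $b=1$ and $\eta=1/\ln n$. If an orientation $\overrightarrow{G}$ of $G$ satisfies $d^+(u)\le(1+\eta b^{ -1})d^+(v)+2$ for every directed edge $\overrightarrow{uv}$, then $\Delta(\overrightarrow{G})\in\mathcal{O}(\rho+\log n)$.
   Context: The maximum subgraph density is $\max|E(H)|/|V(H)|$ over nonempty subgraphs $H$; $d^+(u)$ is the out-degree of $u$ and $\Delta(\overrightarrow{G})$ the maximum out-degree. -}

module Defs where

open import Data.Nat using (ℕ; zero; suc; _+_; _*_; _∸_; _^_; _≤_; _⊔_)
open import Data.Nat using (_!; _<ᵇ_)
open import Data.Fin using (Fin; zero; suc; toℕ)
open import Data.Bool using (Bool; true; false; _∧_; _∨_; if_then_else_)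
open import Data.Product using (Σ; ∃; _×_; _,_; ∃-syntax)
open import Data.Integer using (+_)
import Data.Rational as ℚ
open import Data.Rational using (ℚ)
open import Relation.Binary.PropositionalEquality using (_≡_)
open import Relation.Nullary using (¬_)

sumFin : ∀ {n} → (Fin n → ℕ) → ℕ
sumFin {zero}  f = 0
sumFin {suc n} f = f zero + sumFin {n} (λ i → f (suc i))

count : ∀ {n} → (Fin n → Bool) → ℕ
count P = sumFin (λ i → if P i then 1 else 0)

maxFin : ∀ {n} → (Fin n → ℕ) → ℕ
maxFin {zero}  f = 0
maxFin {suc n} f = f zero ⊔ maxFin {n} (λ i → f (suc i))

record Graph (n : ℕ) : Set where
  field
    adj    : Fin n → Fin n → Bool
    irrefl : ∀ u → adj u u ≡ false
    sym    : ∀ u v → adj u v ≡ adj v u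
open Graph public

-- A subgraph H of G: a vertex set S and an edge set F ⊆ E(G) with both
-- endpoints in S.  An edge {u,v} of H is recorded as F u v for u < v.
record Subgraph {n : ℕ} (G : Graph n) : Set where
  field
    S     : Fin n → Bool
    F     : Fin n → Fin n → Bool
    F⊆E   : ∀ u v → F u v ≡ true → adj G u v ≡ true
    F⊆S×S : ∀ u v → F u v ≡ true → (S u ≡ true) × (S v ≡ true)
open Subgraph public

numV : ∀ {n} {G : Graph n} → Subgraph G → ℕ
numV H = count (S H)

numE : ∀ {n} {G : Graph n} → Subgraph G → ℕ
numE H = sumFin (λ u → count (λ v → (toℕ u <ᵇ toℕ v) ∧ F H u v))

density : ∀ {n} {G : Graph n} (H : Subgraph G) (k : ℕ) → numV H ≡ suc k → ℚ
density H k _ = (+ numE H) ℚ./ suc k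

IsMaxSubgraphDensity : ∀ {n} → Graph n → ℚ → Set
IsMaxSubgraphDensity G ρ =
  (Σ (Subgraph G) λ H → Σ ℕ λ k → Σ (numV H ≡ suc k) λ e → density H k e ≡ ρ)
  × (∀ (H : Subgraph G) (k : ℕ) (e : numV H ≡ suc k) → density H k e ℚ.≤ ρ)

-- D u v = true  means the directed edge u → v.
IsOrientation : ∀ {n} → Graph n → (Fin n → Fin n → Bool) → Set
IsOrientation G D =
  (∀ u v → adj G u v ≡ (D u v ∨ D v u))
  × (∀ u v → ¬ ((D u v ≡ true) × (D v u ≡ true)))

outdeg : ∀ {n} → (Fin n → Fin n → Bool) → Fin n → ℕ
outdeg D u = count (D u)

maxOutdeg : ∀ {n} → (Fin n → Fin n → Bool) → ℕ
maxOutdeg D = maxFin (outdeg D)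

-- The real inequality  k · ln n ≤ b  (k, b, n natural, n ≥ 1),
-- i.e. n^k ≤ e^b, expressed without reals:
-- e^b = Σ_j b^j / j!, and with  expPartial b J = J! · Σ_{j ≤ J} b^j / j!
-- (a natural number), n^k ≤ e^b holds iff n^k · J! ≤ expPartial b J
-- for some J.  (The partial sums increase to e^b; equality e^b = n^k
-- with k ≥ 1 is impossible by irrationality of e^b for b ≥ 1, and for
-- b = 0 all partial sums equal 1 = e^0.)

expPartial : ℕ → ℕ → ℕ
expPartial b zero    = 1
expPartial b (suc J) = suc J * expPartial b J + b ^ suc J

KLnLe : ℕ → ℕ → ℕ → Set
KLnLe n k b = ∃[ J ] (n ^ k * J ! ≤ expPartial b J)

-- The real inequality  a ≤ (1 + 1/ln n) · b + 2   (n ≥ 2), i.e.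
-- (a - b - 2) · ln n ≤ b.  When a ≤ b + 2 this holds trivially
-- (a ∸ b ∸ 2 = 0 and KLnLe n 0 b holds since 1·0! ≤ 1 = expPartial b 0).
LeOnePlusInvLn : ℕ → ℕ → ℕ → Set
LeOnePlusInvLn n a b = KLnLe n (a ∸ b ∸ 2) b

module Submission where

-- Write Δ for the maximum out-degree, L = ⌊log₂ n⌋ and ρ = p/q.  Since e^b ≤ 2·16^b, the
-- hypothesis d⁺(u) ≤ (1 + 1/ln n) d⁺(v) + 2 on an arc u → v gives L d⁺(u) ≤ L d⁺(v) + 4(L + Δ).
-- So the layers S_i = {u : L d⁺(u) + 4i(L + Δ) ≥ L Δ} increase, every arc leaving S_i ends in
-- S_{i+1}, and for 8i ≤ L every vertex of S_i has out-degree at least (Δ - L)/2.  If qΔ > 512p + qL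
-- these out-degrees exceed 256ρ; as all arcs leaving S_i lie in the subgraph induced by S_{i+1},
-- whose density is at most ρ, this forces |S_{i+1}| ≥ 256 |S_i|.  Starting from a vertex of
-- out-degree Δ in S_0, the layer S_{⌊L/8⌋+1} would have 256^{⌊L/8⌋+1} ≥ 2^{L+1} > n vertices.
-- Hence Δ ≤ 512ρ + L ≤ 512(ρ + L).

open import Defs hiding (sym)

module FiniteSums where
  import Algebra.Properties.CommutativeMonoid.Sum as Sum
  open import Data.Bool using (Bool; true; false; if_then_else_)
  open import Data.Fin using (Fin; zero; suc)
  open import Data.Nat
  open import Data.Nat.Properties
  open import Data.Product using (∃-syntax; _,_)
  open import Data.Sum using (inj₁; inj₂)
  open import Relation.Binary.PropositionalEquality using (_≡_; refl; sym; trans; cong; cong₂; subst)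

  open Sum +-0-commutativeMonoid using (sum; ∑-distrib-+; ∑-comm; sum-cong-≗)
  open ≤-Reasoning

  indicator : Bool → ℕ
  indicator b = if b then 1 else 0

  sumOver : ∀ {n} → (Fin n → Bool) → (Fin n → ℕ) → ℕ
  sumOver P f = sumFin (λ i → if P i then f i else 0)

  sumFin≡sum : ∀ {n} (f : Fin n → ℕ) → sumFin f ≡ sum f
  sumFin≡sum {zero}  f = refl
  sumFin≡sum {suc n} f = cong (f zero +_) (sumFin≡sum (λ i → f (suc i)))

  sumFin-cong : ∀ {n} {f g : Fin n → ℕ} → (∀ i → f i ≡ g i) → sumFin f ≡ sumFin g
  sumFin-cong {f = f} {g} f≗g = trans (sumFin≡sum f) (trans (sum-cong-≗ f≗g) (sym (sumFin≡sum g)))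

  sumFin-mono-≤ : ∀ {n} {f g : Fin n → ℕ} → (∀ i → f i ≤ g i) → sumFin f ≤ sumFin g
  sumFin-mono-≤ {zero}  _   = z≤n
  sumFin-mono-≤ {suc n} f≤g = +-mono-≤ (f≤g zero) (sumFin-mono-≤ (λ i → f≤g (suc i)))

  sumFin-+ : ∀ {n} (f g : Fin n → ℕ) → sumFin (λ i → f i + g i) ≡ sumFin f + sumFin g
  sumFin-+ f g = begin-equality
    sumFin (λ i → f i + g i)  ≡⟨ sumFin≡sum (λ i → f i + g i) ⟩
    sum (λ i → f i + g i)     ≡⟨ ∑-distrib-+ f g ⟩
    sum f + sum g             ≡⟨ sym (cong₂ _+_ (sumFin≡sum f) (sumFin≡sum g)) ⟩
    sumFin f + sumFin g       ∎

  sumFin-comm : ∀ {m n} (h : Fin m → Fin n → ℕ) →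
                sumFin (λ i → sumFin (h i)) ≡ sumFin (λ j → sumFin (λ i → h i j))
  sumFin-comm h = begin-equality
    sumFin (λ i → sumFin (h i))          ≡⟨ sumFin²≡sum² h ⟩
    sum (λ i → sum (h i))                ≡⟨ ∑-comm h ⟩
    sum (λ j → sum (λ i → h i j))        ≡⟨ sym (sumFin²≡sum² (λ j i → h i j)) ⟩
    sumFin (λ j → sumFin (λ i → h i j))  ∎
    where
    sumFin²≡sum² : ∀ {m n} (h : Fin m → Fin n → ℕ) →
                   sumFin (λ i → sumFin (h i)) ≡ sum (λ i → sum (h i))
    sumFin²≡sum² h = trans (sumFin≡sum (λ i → sumFin (h i))) (sum-cong-≗ (λ i → sumFin≡sum (h i)))

  count-mono : ∀ {n} (P Q : Fin n → Bool) → (∀ i → P i ≡ true → Q i ≡ true) → count P ≤ count Q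
  count-mono P Q P⊆Q = sumFin-mono-≤ (λ i → indicator-mono (P i) (P⊆Q i))
    where
    indicator-mono : ∀ a {b} → (a ≡ true → b ≡ true) → indicator a ≤ indicator b
    indicator-mono false _   = z≤n
    indicator-mono true  a⇒b rewrite a⇒b refl = ≤-refl

  count≤n : ∀ {n} (P : Fin n → Bool) → count P ≤ n
  count≤n {zero}  P = z≤n
  count≤n {suc n} P = +-mono-≤ (indicator≤1 (P zero)) (count≤n (λ i → P (suc i)))
    where
    indicator≤1 : ∀ b → indicator b ≤ 1
    indicator≤1 false = z≤n
    indicator≤1 true  = ≤-refl

  count-pos : ∀ {n} (P : Fin n → Bool) {i} → P i ≡ true → 0 < count P
  count-pos P {zero}  Pi rewrite Pi = s≤s z≤n
  count-pos P {suc i} Pi = ≤-trans (count-pos (λ j → P (suc j)) Pi) (m≤n+m _ _)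

  *-count≤*-sumOver : ∀ {n} m k (P : Fin n → Bool) (f : Fin n → ℕ) →
                      (∀ i → P i ≡ true → m ≤ k * f i) → m * count P ≤ k * sumOver P f
  *-count≤*-sumOver {zero}  m k P f _    = ≤-trans (≤-reflexive (*-zeroʳ m)) z≤n
  *-count≤*-sumOver {suc n} m k P f m≤kf = begin
    m * (indicator (P zero) + count P⁺)                      ≡⟨ *-distribˡ-+ m (indicator (P zero)) (count P⁺) ⟩
    m * indicator (P zero) + m * count P⁺                    ≤⟨ +-mono-≤ (head (P zero) (m≤kf zero)) tail ⟩
    k * (if P zero then f zero else 0) + k * sumOver P⁺ f⁺  ≡⟨ sym (*-distribˡ-+ k _ (sumOver P⁺ f⁺)) ⟩
    k * sumOver P f                                          ∎
    where
    P⁺ : Fin n → Bool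
    P⁺ i = P (suc i)
    f⁺ : Fin n → ℕ
    f⁺ i = f (suc i)
    head : ∀ b → (b ≡ true → m ≤ k * f zero) → m * indicator b ≤ k * (if b then f zero else 0)
    head false _      = ≤-reflexive (trans (*-zeroʳ m) (sym (*-zeroʳ k)))
    head true  m≤kf₀ = ≤-trans (≤-reflexive (*-identityʳ m)) (m≤kf₀ refl)
    tail : m * count P⁺ ≤ k * sumOver P⁺ f⁺
    tail = *-count≤*-sumOver m k P⁺ f⁺ (λ i → m≤kf (suc i))

  ≤-maxFin : ∀ {n} (f : Fin n → ℕ) i → f i ≤ maxFin f
  ≤-maxFin f zero    = m≤m⊔n _ _
  ≤-maxFin f (suc i) = ≤-trans (≤-maxFin (λ j → f (suc j)) i) (m≤n⊔m _ _)

  maxFin-attained : ∀ {n} (f : Fin n → ℕ) → 0 < maxFin f → ∃[ i ] f i ≡ maxFin f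
  maxFin-attained {suc n} f 0<max with ⊔-sel (f zero) (maxFin (λ j → f (suc j)))
  ... | inj₁ max≡f₀   = zero , sym max≡f₀
  ... | inj₂ max≡rest with maxFin-attained (λ j → f (suc j)) (subst (0 <_) max≡rest 0<max)
  ...   | i , fi≡max = suc i , trans fi≡max (sym max≡rest)

module ExponentialSeries where
  open import Data.List using (_∷_; [])
  open import Data.Nat
  open import Data.Nat.Properties
  open import Data.Nat.Tactic.RingSolver using (solve)
  open import Data.Product using (_,_)
  open import Relation.Binary.PropositionalEquality using (_≡_; refl; sym; cong)
  open import Algebra.Properties.CommutativeSemigroup *-commutativeSemigroup
    using (interchange; x∙yz≈y∙xz; xy∙z≈xz∙y)

  open ≤-Reasoning

  ^-distribʳ-* : ∀ m n o → (m * n) ^ o ≡ m ^ o * n ^ o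
  ^-distribʳ-* m n zero    = refl
  ^-distribʳ-* m n (suc o) = begin-equality
    m * n * (m * n) ^ o      ≡⟨ cong (m * n *_) (^-distribʳ-* m n o) ⟩
    m * n * (m ^ o * n ^ o)  ≡⟨ interchange m n (m ^ o) (n ^ o) ⟩
    m * m ^ o * (n * n ^ o)  ∎

  2^-cancel-≤ : ∀ {m n} → 2 ^ m ≤ 2 ^ n → m ≤ n
  2^-cancel-≤ 2^m≤2^n = ≮⇒≥ (λ n<m → <⇒≱ (^-monoʳ-< 2 (s≤s (s≤s z≤n)) n<m) 2^m≤2^n)

  2^-cancel-< : ∀ {m n} → 2 ^ m < 2 ^ n → m < n
  2^-cancel-< 2^m<2^n = ≰⇒> (λ n≤m → <⇒≱ 2^m<2^n (^-monoʳ-≤ 2 n≤m))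

  !*^≤! : ∀ x j → x ! * x ^ j ≤ (j + x) !
  !*^≤! x zero    = ≤-reflexive (*-identityʳ (x !))
  !*^≤! x (suc j) = begin
    x ! * (x * x ^ j)        ≡⟨ x∙yz≈y∙xz (x !) x (x ^ j) ⟩
    x * (x ! * x ^ j)        ≤⟨ *-mono-≤ (m≤n+m x (suc j)) (!*^≤! x j) ⟩
    (suc j + x) * (j + x) !  ∎

  !≤2^*!*! : ∀ x j → (x + j) ! ≤ 2 ^ (x + j) * (x ! * j !)
  !≤2^*!*! zero j = begin
    j !                ≤⟨ m≤n*m (j !) (2 ^ j) {{m^n≢0 2 j}} ⟩
    2 ^ j * j !        ≡⟨ cong (2 ^ j *_) (sym (*-identityˡ (j !))) ⟩
    2 ^ j * (1 * j !)  ∎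
  !≤2^*!*! (suc x) zero rewrite +-identityʳ x | *-identityʳ (suc x !) =
    m≤n*m (suc x !) (2 ^ suc x) {{m^n≢0 2 (suc x)}}
  !≤2^*!*! (suc x) (suc j) = begin
    suc N * N !                ≡⟨ *-distribʳ-+ (N !) (suc x) (suc j) ⟩
    suc x * N ! + suc j * N !  ≤⟨ +-mono-≤ left right ⟩
    2 ^ N * X + 2 ^ N * X      ≡⟨ sym (*-distribʳ-+ X (2 ^ N) (2 ^ N)) ⟩
    (2 ^ N + 2 ^ N) * X        ≡⟨ cong (λ m → (2 ^ N + m) * X) (sym (+-identityʳ (2 ^ N))) ⟩
    2 ^ suc N * X              ∎
    where
    N X : ℕ
    N = x + suc j
    X = suc x ! * suc j !
    left : suc x * N ! ≤ 2 ^ N * X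
    left = begin
      suc x * N !                        ≤⟨ *-monoʳ-≤ (suc x) (!≤2^*!*! x (suc j)) ⟩
      suc x * (2 ^ N * (x ! * suc j !))  ≡⟨ x∙yz≈y∙xz (suc x) (2 ^ N) _ ⟩
      2 ^ N * (suc x * (x ! * suc j !))  ≡⟨ cong (2 ^ N *_) (sym (*-assoc (suc x) (x !) (suc j !))) ⟩
      2 ^ N * X                          ∎
    right : suc j * N ! ≤ 2 ^ N * X
    right = begin
      suc j * N !                                  ≡⟨ cong (λ m → suc j * m !) (+-suc x j) ⟩
      suc j * (suc x + j) !                        ≤⟨ *-monoʳ-≤ (suc j) (!≤2^*!*! (suc x) j) ⟩
      suc j * (2 ^ (suc x + j) * (suc x ! * j !))  ≡⟨ cong (λ m → suc j * (2 ^ m * (suc x ! * j !))) (sym (+-suc x j)) ⟩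
      suc j * (2 ^ N * (suc x ! * j !))            ≡⟨ x∙yz≈y∙xz (suc j) (2 ^ N) _ ⟩
      2 ^ N * (suc j * (suc x ! * j !))            ≡⟨ cong (2 ^ N *_) (x∙yz≈y∙xz (suc j) (suc x !) (j !)) ⟩
      2 ^ N * X                                    ∎

  ^≤!*2^ : ∀ x j → x ^ j ≤ j ! * 2 ^ (j + x)
  ^≤!*2^ x j = *-cancelˡ-≤ (x !) {{x !≢0}} (begin
    x ! * x ^ j                    ≤⟨ !*^≤! x j ⟩
    (j + x) !                      ≤⟨ !≤2^*!*! j x ⟩
    2 ^ (j + x) * (j ! * x !)      ≡⟨ x∙yz≈y∙xz (2 ^ (j + x)) (j !) (x !) ⟩
    j ! * (2 ^ (j + x) * x !)      ≡⟨ cong (j ! *_) (*-comm (2 ^ (j + x)) (x !)) ⟩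
    j ! * (x ! * 2 ^ (j + x))      ≡⟨ x∙yz≈y∙xz (j !) (x !) (2 ^ (j + x)) ⟩
    x ! * (j ! * 2 ^ (j + x))      ∎)

  ^*2^≤16^*! : ∀ b j → b ^ j * 2 ^ j ≤ 16 ^ b * j !
  ^*2^≤16^*! b j = *-cancelˡ-≤ (2 ^ j) {{m^n≢0 2 j}} (begin
    2 ^ j * (b ^ j * 2 ^ j)      ≡⟨ x∙yz≈y∙xz (2 ^ j) (b ^ j) (2 ^ j) ⟩
    b ^ j * (2 ^ j * 2 ^ j)      ≡⟨ cong (b ^ j *_) (sym (^-distribʳ-* 2 2 j)) ⟩
    b ^ j * 4 ^ j                ≡⟨ *-comm (b ^ j) (4 ^ j) ⟩
    4 ^ j * b ^ j                ≡⟨ sym (^-distribʳ-* 4 b j) ⟩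
    (4 * b) ^ j                  ≤⟨ ^≤!*2^ (4 * b) j ⟩
    j ! * 2 ^ (j + 4 * b)        ≡⟨ cong (j ! *_) (^-distribˡ-+-* 2 j (4 * b)) ⟩
    j ! * (2 ^ j * 2 ^ (4 * b))  ≡⟨ cong (λ m → j ! * (2 ^ j * m)) (sym (^-*-assoc 2 4 b)) ⟩
    j ! * (2 ^ j * 16 ^ b)       ≡⟨ x∙yz≈y∙xz (j !) (2 ^ j) (16 ^ b) ⟩
    2 ^ j * (j ! * 16 ^ b)       ≡⟨ cong (2 ^ j *_) (*-comm (j !) (16 ^ b)) ⟩
    2 ^ j * (16 ^ b * j !)       ∎)

  private
    expPartial-step : ∀ j E P B S F → E * P + S * F ≤ 2 * P * (S * F) → B * (2 * P) ≤ S * (j * F) →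
                      (j * E + B) * (2 * P) + S * (j * F) ≤ 2 * (2 * P) * (S * (j * F))
    expPartial-step j E P B S F ih term = begin
      (j * E + B) * (2 * P) + S * (j * F)            ≡⟨ solve (j ∷ E ∷ P ∷ B ∷ S ∷ F ∷ []) ⟩
      2 * j * (E * P) + (B * (2 * P) + S * (j * F))  ≤⟨ +-monoʳ-≤ (2 * j * (E * P)) (+-monoˡ-≤ (S * (j * F)) term) ⟩
      2 * j * (E * P) + (S * (j * F) + S * (j * F))  ≡⟨ solve (j ∷ E ∷ P ∷ S ∷ F ∷ []) ⟩
      2 * j * (E * P + S * F)                        ≤⟨ *-monoʳ-≤ (2 * j) ih ⟩
      2 * j * (2 * P * (S * F))                      ≡⟨ solve (j ∷ P ∷ S ∷ F ∷ []) ⟩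
      2 * (2 * P) * (S * (j * F))                    ∎

  -- Σ_{j ≤ J} b^j/j! ≤ 16^b (2 - 2^-J), multiplied by J! 2^J.
  expPartial*2^+16^*!≤ : ∀ b J → expPartial b J * 2 ^ J + 16 ^ b * J ! ≤ 2 ^ suc J * (16 ^ b * J !)
  expPartial*2^+16^*!≤ b zero = begin
    1 + T  ≤⟨ +-monoˡ-≤ T (≤-trans (m^n>0 16 b) (m≤m*n (16 ^ b) 1)) ⟩
    T + T  ≡⟨ cong (T +_) (sym (+-identityʳ T)) ⟩
    2 * T  ∎
    where
    T : ℕ
    T = 16 ^ b * 1
  expPartial*2^+16^*!≤ b (suc J) =
    expPartial-step (suc J) (expPartial b J) (2 ^ J) (b ^ suc J) (16 ^ b) (J !)
      (expPartial*2^+16^*!≤ b J) (^*2^≤16^*! b (suc J))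

  expPartial≤2*16^*! : ∀ b J → expPartial b J ≤ 2 * (16 ^ b * J !)
  expPartial≤2*16^*! b J = *-cancelʳ-≤ _ _ (2 ^ J) {{m^n≢0 2 J}} (begin
    expPartial b J * 2 ^ J                     ≤⟨ m≤m+n _ _ ⟩
    expPartial b J * 2 ^ J + 16 ^ b * J !      ≤⟨ expPartial*2^+16^*!≤ b J ⟩
    2 * 2 ^ J * (16 ^ b * J !)                 ≡⟨ xy∙z≈xz∙y 2 (2 ^ J) (16 ^ b * J !) ⟩
    2 * (16 ^ b * J !) * 2 ^ J                 ∎)

  KLnLe⇒L*k≤1+4b : ∀ {n k b L} → 2 ^ L ≤ n → KLnLe n k b → L * k ≤ 1 + 4 * b
  KLnLe⇒L*k≤1+4b {n} {k} {b} {L} 2^L≤n (J , n^k*J!≤expPartial) =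
    2^-cancel-≤ (*-cancelʳ-≤ _ _ (J !) {{J !≢0}} (begin
      2 ^ (L * k) * J !      ≡⟨ cong (_* J !) (sym (^-*-assoc 2 L k)) ⟩
      (2 ^ L) ^ k * J !      ≤⟨ *-monoˡ-≤ (J !) (^-monoˡ-≤ k 2^L≤n) ⟩
      n ^ k * J !            ≤⟨ n^k*J!≤expPartial ⟩
      expPartial b J         ≤⟨ expPartial≤2*16^*! b J ⟩
      2 * (16 ^ b * J !)     ≡⟨ sym (*-assoc 2 (16 ^ b) (J !)) ⟩
      2 * 16 ^ b * J !       ≡⟨ cong (λ m → 2 * m * J !) (^-*-assoc 2 4 b) ⟩
      2 ^ (1 + 4 * b) * J !  ∎))

  LeOnePlusInvLn⇒ : ∀ {n L a b} → 1 ≤ L → 2 ^ L ≤ n → LeOnePlusInvLn n a b → L * a ≤ L * b + 4 * (L + b)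
  LeOnePlusInvLn⇒ {L = L} {a} {b} 1≤L 2^L≤n a≲b =
    bound (a ∸ b ∸ 2) a≤b+[2+k] (KLnLe⇒L*k≤1+4b {k = a ∸ b ∸ 2} {L = L} 2^L≤n a≲b)
    where
    a≤b+[2+k] : a ≤ b + (2 + (a ∸ b ∸ 2))
    a≤b+[2+k] = ≤-trans (m≤n+m∸n a b) (+-monoʳ-≤ b (m≤n+m∸n (a ∸ b) 2))
    bound : ∀ k → a ≤ b + (2 + k) → L * k ≤ 1 + 4 * b → L * a ≤ L * b + 4 * (L + b)
    bound k a≤b+[2+k] Lk≤1+4b = begin
      L * a                                ≤⟨ *-monoʳ-≤ L a≤b+[2+k] ⟩
      L * (b + (2 + k))                    ≡⟨ solve (L ∷ b ∷ k ∷ []) ⟩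
      L * b + (2 * L + L * k)              ≤⟨ +-monoʳ-≤ (L * b) (+-monoʳ-≤ (2 * L) Lk≤L+4b) ⟩
      L * b + (2 * L + (L + 4 * b))        ≤⟨ +-monoʳ-≤ (L * b) (m≤n+m _ L) ⟩
      L * b + (L + (2 * L + (L + 4 * b)))  ≡⟨ solve (L ∷ b ∷ []) ⟩
      L * b + 4 * (L + b)                  ∎
      where
      Lk≤L+4b : L * k ≤ L + 4 * b
      Lk≤L+4b = ≤-trans Lk≤1+4b (+-monoˡ-≤ (4 * b) 1≤L)

module InducedSubgraphs where
  open import Data.Bool using (Bool; true; false; T; _∧_; _∨_; if_then_else_)
  open import Data.Bool.Properties using (∧-conicalˡ; ∧-conicalʳ)
  open import Data.Empty using (⊥-elim)
  open import Data.Fin using (Fin; toℕ)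
  open import Data.Fin.Properties using (toℕ-injective)
  open import Data.Nat
  open import Data.Nat.Properties
  open import Data.Product using (_×_; _,_; proj₁; proj₂)
  open import Data.Sum using (_⊎_; inj₁; inj₂; reduce)
  open import Relation.Binary.Definitions using (tri<; tri≈; tri>)
  open import Relation.Binary.PropositionalEquality using (_≡_; refl; sym; trans; cong)
  open import Relation.Nullary using (¬_)
  open FiniteSums

  open ≤-Reasoning

  induced : ∀ {n} (G : Graph n) → (Fin n → Bool) → Subgraph G
  induced G Q = record
    { S     = Q
    ; F     = λ u v → Q u ∧ Q v ∧ adj G u v
    ; F⊆E   = λ u v uv∈F → ∧-conicalʳ (Q v) _ (∧-conicalʳ (Q u) _ uv∈F)
    ; F⊆S×S = λ u v uv∈F → ∧-conicalˡ (Q u) _ uv∈F , ∧-conicalˡ (Q v) _ (∧-conicalʳ (Q u) _ uv∈F)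
    }

  DensityBoundedBy : ∀ {n} → Graph n → ℕ → ℕ → Set
  DensityBoundedBy G p q = ∀ (H : Subgraph G) → 0 < numV H → numE H * q ≤ p * numV H

  private
    ∧-true : ∀ {a b} → a ≡ true → b ≡ true → (a ∧ b) ≡ true
    ∧-true refl refl = refl

    indicator-≤-split : ∀ a b c → (c ≡ true → T a ⊎ T b) →
                        indicator c ≤ indicator (a ∧ c) + indicator (b ∧ c)
    indicator-≤-split a     b     false _     = z≤n
    indicator-≤-split true  b     true  _     = s≤s z≤n
    indicator-≤-split false true  true  _     = ≤-refl
    indicator-≤-split false false true  c⇒a∨b = ⊥-elim (reduce (c⇒a∨b refl))

    indicator-pair≤ : ∀ l x y d e → ¬ (d ≡ true × e ≡ true) →
                      indicator (l ∧ x ∧ y ∧ d) + indicator (l ∧ y ∧ x ∧ e) ≤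
                      indicator (l ∧ x ∧ y ∧ (d ∨ e))
    indicator-pair≤ false x     y     d     e     _     = z≤n
    indicator-pair≤ true  false false d     e     _     = z≤n
    indicator-pair≤ true  false true  d     e     _     = z≤n
    indicator-pair≤ true  true  false d     e     _     = z≤n
    indicator-pair≤ true  true  true  false false _     = z≤n
    indicator-pair≤ true  true  true  false true  _     = ≤-refl
    indicator-pair≤ true  true  true  true  false _     = ≤-refl
    indicator-pair≤ true  true  true  true  true  ¬both = ⊥-elim (¬both (refl , refl))

  module _ {n} (G : Graph n) (D : Fin n → Fin n → Bool) (orient : IsOrientation G D) where

    private
      _≺_ : Fin n → Fin n → Bool
      u ≺ v = toℕ u <ᵇ toℕ v

      Σ² : (Fin n → Fin n → ℕ) → ℕ
      Σ² h = sumFin (λ u → sumFin (h u))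

      Σ²-mono-≤ : ∀ {g h} → (∀ u v → g u v ≤ h u v) → Σ² g ≤ Σ² h
      Σ²-mono-≤ g≤h = sumFin-mono-≤ (λ u → sumFin-mono-≤ (g≤h u))

      Σ²-+ : ∀ g h → Σ² (λ u v → g u v + h u v) ≡ Σ² g + Σ² h
      Σ²-+ g h = trans (sumFin-cong (λ u → sumFin-+ (g u) (h u)))
                       (sumFin-+ (λ u → sumFin (g u)) (λ u → sumFin (h u)))

      arc-ends-ordered : ∀ {u v} → D u v ≡ true → T (u ≺ v) ⊎ T (v ≺ u)
      arc-ends-ordered {u} {v} uv∈D with <-cmp (toℕ u) (toℕ v)
      ... | tri< u<v _ _ = inj₁ (<⇒<ᵇ u<v)
      ... | tri> _ _ v<u = inj₂ (<⇒<ᵇ v<u)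
      ... | tri≈ _ u≡v _ rewrite toℕ-injective u≡v = ⊥-elim (proj₂ orient v v (uv∈D , uv∈D))

    -- An arc between u ≺ v is charged to the edge {u, v}; no edge is charged twice as D is antisymmetric.
    arcs≤numE-induced : ∀ Q → sumFin (λ u → count (λ v → Q u ∧ Q v ∧ D u v)) ≤ numE (induced G Q)
    arcs≤numE-induced Q = begin
      Σ² (λ u v → [ A u v ])
        ≤⟨ Σ²-mono-≤ split ⟩
      Σ² (λ u v → [ u ≺ v ∧ A u v ] + [ v ≺ u ∧ A u v ])
        ≡⟨ Σ²-+ _ _ ⟩
      Σ² (λ u v → [ u ≺ v ∧ A u v ]) + Σ² (λ u v → [ v ≺ u ∧ A u v ])
        ≡⟨ cong (Σ² (λ u v → [ u ≺ v ∧ A u v ]) +_) (sumFin-comm (λ u v → [ v ≺ u ∧ A u v ])) ⟩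
      Σ² (λ u v → [ u ≺ v ∧ A u v ]) + Σ² (λ u v → [ u ≺ v ∧ A v u ])
        ≡⟨ sym (Σ²-+ _ _) ⟩
      Σ² (λ u v → [ u ≺ v ∧ A u v ] + [ u ≺ v ∧ A v u ])
        ≤⟨ Σ²-mono-≤ pair ⟩
      numE (induced G Q)
        ∎
      where
      A : Fin n → Fin n → Bool
      A u v = Q u ∧ Q v ∧ D u v
      [_] : Bool → ℕ
      [_] = indicator
      split : ∀ u v → [ A u v ] ≤ [ u ≺ v ∧ A u v ] + [ v ≺ u ∧ A u v ]
      split u v = indicator-≤-split (u ≺ v) (v ≺ u) (A u v)
        (λ uv∈A → arc-ends-ordered (∧-conicalʳ (Q v) _ (∧-conicalʳ (Q u) _ uv∈A)))
      pair : ∀ u v → [ u ≺ v ∧ A u v ] + [ u ≺ v ∧ A v u ] ≤ [ u ≺ v ∧ Q u ∧ Q v ∧ adj G u v ]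
      pair u v rewrite proj₁ orient u v =
        indicator-pair≤ (u ≺ v) (Q u) (Q v) (D u v) (D v u) (proj₂ orient u v)

    sumOver-outdeg≤numE-induced : ∀ P Q →
      (∀ u v → P u ≡ true → D u v ≡ true → Q u ≡ true × Q v ≡ true) →
      sumOver P (outdeg D) ≤ numE (induced G Q)
    sumOver-outdeg≤numE-induced P Q closed = ≤-trans (sumFin-mono-≤ arcs-from) (arcs≤numE-induced Q)
      where
      arcs-from : ∀ u → (if P u then outdeg D u else 0) ≤ count (λ v → Q u ∧ Q v ∧ D u v)
      arcs-from u with P u in u∈P
      ... | false = z≤n
      ... | true  = count-mono (D u) (λ v → Q u ∧ Q v ∧ D u v) λ v uv∈D →
        let u∈Q , v∈Q = closed u v u∈P uv∈D in ∧-true u∈Q (∧-true v∈Q uv∈D)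

module OutdegreeBound where
  open import Data.Bool using (Bool; true)
  open import Data.Bool.Properties using (T-≡)
  open import Data.Empty using (⊥)
  open import Data.Fin using (Fin)
  open import Data.List using (_∷_; [])
  open import Data.Nat
  open import Data.Nat.DivMod using (m≡m%n+[m/n]*n; m%n<n; m/n*n≤m)
  open import Data.Nat.Logarithm using (⌊log₂_⌋; ⌊log₂⌋-mono-≤; ⌊log₂[2^n]⌋≡n)
  open import Data.Nat.Properties
  open import Data.Nat.Tactic.RingSolver using (solve)
  open import Data.Product using (∃-syntax; _×_; _,_)
  open import Data.Sum using (inj₁; inj₂)
  open import Function.Bundles using (Equivalence)
  open import Relation.Binary.PropositionalEquality using (_≡_; sym; cong; subst)
  open import Algebra.Properties.CommutativeSemigroup *-commutativeSemigroup using (x∙yz≈y∙xz; x∙yz≈yx∙z)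
  open FiniteSums
  open ExponentialSeries
  open InducedSubgraphs

  open ≤-Reasoning

  private
    L*Δ≤L*[2x+L] : ∀ {L Δ x i} → i * 8 ≤ L → L * Δ ≤ L * x + i * (4 * (L + Δ)) → L * Δ ≤ L * (2 * x + L)
    L*Δ≤L*[2x+L] {L} {Δ} {x} {i} 8i≤L LΔ≤ = +-cancelʳ-≤ (L * Δ) _ _ (begin
      L * Δ + L * Δ                    ≡⟨ solve (L ∷ Δ ∷ []) ⟩
      2 * (L * Δ)                      ≤⟨ *-monoʳ-≤ 2 LΔ≤ ⟩
      2 * (L * x + i * (4 * (L + Δ)))  ≡⟨ solve (L ∷ Δ ∷ x ∷ i ∷ []) ⟩
      L * (2 * x) + i * 8 * (L + Δ)    ≤⟨ +-monoʳ-≤ (L * (2 * x)) (*-monoˡ-≤ (L + Δ) 8i≤L) ⟩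
      L * (2 * x) + L * (L + Δ)        ≡⟨ solve (L ∷ Δ ∷ x ∷ []) ⟩
      L * (2 * x + L) + L * Δ          ∎)

  module LayerArgument
    {n} (G : Graph n) (D : Fin n → Fin n → Bool) (orient : IsOrientation G D)
    (L : ℕ) .{{_ : NonZero L}} (n<2^[1+L] : n < 2 ^ suc L)
    (balanced : ∀ u v → D u v ≡ true → L * outdeg D u ≤ L * outdeg D v + 4 * (L + maxOutdeg D))
    (p q : ℕ) (sparse : DensityBoundedBy G p q)
    where

    private
      d : Fin n → ℕ
      d = outdeg D
      Δ s : ℕ
      Δ = maxOutdeg D
      s = 4 * (L + Δ)

    layer : ℕ → Fin n → Bool
    layer i u = L * Δ ≤ᵇ L * d u + i * s

    layer-intro : ∀ i {u} → L * Δ ≤ L * d u + i * s → layer i u ≡ true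
    layer-intro i h = Equivalence.to T-≡ (≤⇒≤ᵇ h)

    layer-elim : ∀ i {u} → layer i u ≡ true → L * Δ ≤ L * d u + i * s
    layer-elim i u∈layer = ≤ᵇ⇒≤ _ _ (Equivalence.from T-≡ u∈layer)

    layer-suc : ∀ i {u} → layer i u ≡ true → layer (suc i) u ≡ true
    layer-suc i {u} u∈layer =
      layer-intro (suc i) (≤-trans (layer-elim i u∈layer) (+-monoʳ-≤ (L * d u) (m≤n+m (i * s) s)))

    arc-into-next-layer : ∀ i {u v} → layer i u ≡ true → D u v ≡ true → layer (suc i) v ≡ true
    arc-into-next-layer i {u} {v} u∈layer uv∈D = layer-intro (suc i) (begin
      L * Δ                ≤⟨ layer-elim i u∈layer ⟩
      L * d u + i * s      ≤⟨ +-monoˡ-≤ (i * s) (balanced u v uv∈D) ⟩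
      L * d v + s + i * s  ≡⟨ +-assoc (L * d v) s (i * s) ⟩
      L * d v + suc i * s  ∎)

    layer-degree : ∀ i {u} → i * 8 ≤ L → layer i u ≡ true → Δ ≤ 2 * d u + L
    layer-degree i 8i≤L u∈layer = *-cancelˡ-≤ L (L*Δ≤L*[2x+L] {i = i} 8i≤L (layer-elim i u∈layer))

    module _ (heavy : 512 * p + q * L < q * Δ) where

      layer-heavy : ∀ i {u} → i * 8 ≤ L → layer i u ≡ true → 256 * p < q * d u
      layer-heavy i {u} 8i≤L u∈layer = *-cancelˡ-< 2 _ _ (+-cancelʳ-< (q * L) _ _ (begin-strict
        2 * (256 * p) + q * L        ≡⟨ cong (_+ q * L) (sym (*-assoc 2 256 p)) ⟩
        512 * p + q * L              <⟨ heavy ⟩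
        q * Δ                        ≤⟨ *-monoʳ-≤ q (layer-degree i 8i≤L u∈layer) ⟩
        q * (2 * d u + L)            ≡⟨ *-distribˡ-+ q (2 * d u) L ⟩
        q * (2 * d u) + q * L        ≡⟨ cong (_+ q * L) (x∙yz≈y∙xz q 2 (d u)) ⟩
        2 * (q * d u) + q * L        ∎))

      layer-growth : ∀ i → i * 8 ≤ L → 0 < count (layer i) → 256 * count (layer i) ≤ count (layer (suc i))
      layer-growth i 8i≤L 0<c = <⇒≤ (*-cancelˡ-< p _ _ (begin-strict
        p * (256 * c)            <⟨ m<n+m _ 0<c ⟩
        c + p * (256 * c)        ≡⟨ cong (c +_) (x∙yz≈yx∙z p 256 c) ⟩
        suc (256 * p) * c        ≤⟨ *-count≤*-sumOver _ q (layer i) d (λ u → layer-heavy i 8i≤L) ⟩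
        q * sumOver (layer i) d  ≤⟨ *-monoʳ-≤ q (sumOver-outdeg≤numE-induced G D orient _ _ closed) ⟩
        q * numE H               ≡⟨ *-comm q (numE H) ⟩
        numE H * q               ≤⟨ sparse H 0<|H| ⟩
        p * count (layer (suc i)) ∎))
        where
        c : ℕ
        c = count (layer i)
        H : Subgraph G
        H = induced G (layer (suc i))
        0<|H| : 0 < numV H
        0<|H| = ≤-trans 0<c (count-mono (layer i) (layer (suc i)) (λ u → layer-suc i))
        closed : ∀ u v → layer i u ≡ true → D u v ≡ true → layer (suc i) u ≡ true × layer (suc i) v ≡ true
        closed u v u∈layer uv∈D = layer-suc i u∈layer , arc-into-next-layer i u∈layer uv∈D

      0<Δ : 0 < Δ
      0<Δ = >-nonZero⁻¹ Δ {{m*n≢0⇒n≢0 q {{>-nonZero (≤-<-trans z≤n heavy)}}}}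

      layer₀-nonempty : 0 < count (layer 0)
      layer₀-nonempty with maxFin-attained d 0<Δ
      ... | u , du≡Δ = count-pos (layer 0) (layer-intro 0 (≤-reflexive (begin-equality
        L * Δ        ≡⟨ cong (L *_) (sym du≡Δ) ⟩
        L * d u      ≡⟨ sym (+-identityʳ (L * d u)) ⟩
        L * d u + 0  ∎)))

      layer-size : ∀ i → i * 8 ≤ L → 256 ^ suc i ≤ count (layer (suc i))
      layer-size zero    _       = ≤-trans (*-monoʳ-≤ 256 layer₀-nonempty) (layer-growth 0 z≤n layer₀-nonempty)
      layer-size (suc i) 8i+8≤L =
        ≤-trans (*-monoʳ-≤ 256 ih) (layer-growth (suc i) 8i+8≤L (≤-trans (m^n>0 256 (suc i)) ih))
        where
        ih : 256 ^ suc i ≤ count (layer (suc i))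
        ih = layer-size i (≤-trans (m≤n+m (i * 8) 8) 8i+8≤L)

      impossible : ⊥
      impossible = <⇒≱ (begin-strict
          n                  <⟨ n<2^[1+L] ⟩
          2 ^ suc L          ≤⟨ ^-monoʳ-≤ 2 1+L≤[1+i]*8 ⟩
          2 ^ (suc i * 8)    ≡⟨ cong (2 ^_) (*-comm (suc i) 8) ⟩
          2 ^ (8 * suc i)    ≡⟨ sym (^-*-assoc 2 8 (suc i)) ⟩
          256 ^ suc i        ∎)
        (≤-trans (layer-size i (m/n*n≤m L 8)) (count≤n (layer (suc i))))
        where
        i : ℕ
        i = L / 8
        1+L≤[1+i]*8 : suc L ≤ suc i * 8
        1+L≤[1+i]*8 = begin
          suc L                ≡⟨ cong suc (m≡m%n+[m/n]*n L 8) ⟩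
          suc (L % 8 + i * 8)  ≤⟨ +-monoˡ-≤ (i * 8) (m%n<n L 8) ⟩
          8 + i * 8            ∎

    q*Δ≤512*p+q*L : q * Δ ≤ 512 * p + q * L
    q*Δ≤512*p+q*L = ≮⇒≥ impossible

  ∃[ℓ]2^ℓ≤n<2^[1+ℓ] : ∀ {n} → 0 < n → ∃[ ℓ ] (2 ^ ℓ ≤ n × n < 2 ^ suc ℓ)
  ∃[ℓ]2^ℓ≤n<2^[1+ℓ] {suc zero}    _ = 0 , ≤-refl , s≤s (s≤s z≤n)
  ∃[ℓ]2^ℓ≤n<2^[1+ℓ] {suc (suc n)} _ with ∃[ℓ]2^ℓ≤n<2^[1+ℓ] {suc n} (s≤s z≤n)
  ... | ℓ , 2^ℓ≤n , n<2^[1+ℓ] with m≤n⇒m<n∨m≡n n<2^[1+ℓ]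
  ...   | inj₁ 1+n<2^[1+ℓ] = ℓ , m≤n⇒m≤1+n 2^ℓ≤n , 1+n<2^[1+ℓ]
  ...   | inj₂ 1+n≡2^[1+ℓ] = suc ℓ , ≤-reflexive (sym 1+n≡2^[1+ℓ]) ,
    subst (_< 2 ^ suc (suc ℓ)) (sym 1+n≡2^[1+ℓ]) (^-monoʳ-< 2 (s≤s (s≤s z≤n)) (n<1+n (suc ℓ)))

  maxOutdeg*q≤512*[p+⌊log₂n⌋*q] :
    ∀ {n} → 2 ≤ n → (G : Graph n) (p q : ℕ) → DensityBoundedBy G p q →
    (D : Fin n → Fin n → Bool) → IsOrientation G D →
    (∀ u v → D u v ≡ true → LeOnePlusInvLn n (outdeg D u) (outdeg D v)) →
    maxOutdeg D * q ≤ 512 * (p + ⌊log₂ n ⌋ * q)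
  maxOutdeg*q≤512*[p+⌊log₂n⌋*q] {n} 2≤n G p q sparse D orient locally-balanced
    with ∃[ℓ]2^ℓ≤n<2^[1+ℓ] (≤-trans (s≤s z≤n) 2≤n)
  ... | ℓ , 2^ℓ≤n , n<2^[1+ℓ] = begin
    maxOutdeg D * q                  ≡⟨ *-comm (maxOutdeg D) q ⟩
    q * maxOutdeg D                  ≤⟨ q*Δ≤512*p+q*ℓ ⟩
    512 * p + q * ℓ                  ≤⟨ +-monoʳ-≤ (512 * p) (*-monoʳ-≤ q ℓ≤⌊log₂n⌋) ⟩
    512 * p + q * ⌊log₂ n ⌋          ≤⟨ +-monoʳ-≤ (512 * p) (m≤n*m (q * ⌊log₂ n ⌋) 512) ⟩
    512 * p + 512 * (q * ⌊log₂ n ⌋)  ≡⟨ sym (*-distribˡ-+ 512 p (q * ⌊log₂ n ⌋)) ⟩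
    512 * (p + q * ⌊log₂ n ⌋)        ≡⟨ cong (λ x → 512 * (p + x)) (*-comm q ⌊log₂ n ⌋) ⟩
    512 * (p + ⌊log₂ n ⌋ * q)        ∎
    where
    1≤ℓ : 1 ≤ ℓ
    1≤ℓ = ≤-pred (2^-cancel-< {1} (≤-<-trans 2≤n n<2^[1+ℓ]))
    ℓ≤⌊log₂n⌋ : ℓ ≤ ⌊log₂ n ⌋
    ℓ≤⌊log₂n⌋ = subst (_≤ ⌊log₂ n ⌋) (⌊log₂[2^n]⌋≡n ℓ) (⌊log₂⌋-mono-≤ 2^ℓ≤n)
    balanced : ∀ u v → D u v ≡ true → ℓ * outdeg D u ≤ ℓ * outdeg D v + 4 * (ℓ + maxOutdeg D)
    balanced u v uv∈D = ≤-trans (LeOnePlusInvLn⇒ 1≤ℓ 2^ℓ≤n (locally-balanced u v uv∈D))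
      (+-monoʳ-≤ (ℓ * outdeg D v) (*-monoʳ-≤ 4 (+-monoʳ-≤ ℓ (≤-maxFin (outdeg D) v))))
    q*Δ≤512*p+q*ℓ : q * maxOutdeg D ≤ 512 * p + q * ℓ
    q*Δ≤512*p+q*ℓ = LayerArgument.q*Δ≤512*p+q*L G D orient ℓ {{>-nonZero 1≤ℓ}} n<2^[1+ℓ] balanced p q sparse

module Fractions where
  open import Data.Empty using (⊥-elim)
  open import Data.Integer as ℤ using (+_; -[1+_])
  import Data.Integer.Properties as ℤ
  open import Data.Nat as ℕ using (suc; NonZero)
  import Data.Nat.Properties as ℕ
  open import Data.Product using (∃-syntax; _,_)
  open import Data.Rational as ℚ using (ℚ; mkℚ; _/_; toℚᵘ)
  import Data.Rational.Properties as ℚ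
  import Data.Rational.Unnormalised as ℚᵘ
  import Data.Rational.Unnormalised.Properties as ℚᵘ
  open import Relation.Binary.PropositionalEquality using (_≡_; sym; trans; cong; subst₂; module ≡-Reasoning)
  open InducedSubgraphs using (DensityBoundedBy)

  toℚᵘ-+/ : ∀ a q .{{_ : NonZero q}} → toℚᵘ ((+ a) / q) ℚᵘ.≃ (+ a) ℚᵘ./ q
  toℚᵘ-+/ a (suc l) = ℚ.toℚᵘ-fromℚᵘ (ℚᵘ.mkℚᵘ (+ a) l)

  a/k≤b/l⇒a*l≤b*k : ∀ a k b l .{{_ : NonZero k}} .{{_ : NonZero l}} →
                    (+ a) / k ℚ.≤ (+ b) / l → a ℕ.* l ℕ.≤ b ℕ.* k
  a/k≤b/l⇒a*l≤b*k a k@(suc _) b l@(suc _) a/k≤b/l =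
    ℤ.drop‿+≤+ (subst₂ ℤ._≤_ (sym (ℤ.pos-* a l)) (sym (ℤ.pos-* b k)) (ℚᵘ.drop-*≤* a/k≤b/lᵘ))
    where
    a/k≤b/lᵘ : (+ a) ℚᵘ./ k ℚᵘ.≤ (+ b) ℚᵘ./ l
    a/k≤b/lᵘ = ℚᵘ.≤-respʳ-≃ (toℚᵘ-+/ b l) (ℚᵘ.≤-respˡ-≃ (toℚᵘ-+/ a k) (ℚ.toℚᵘ-mono-≤ a/k≤b/l))

  m*q≤k*[p+L*q]⇒m≤k*[p/q+L] : ∀ m k p q L .{{_ : NonZero q}} → m ℕ.* q ℕ.≤ k ℕ.* (p ℕ.+ L ℕ.* q) →
                               (+ m) / 1 ℚ.≤ (+ k) / 1 ℚ.* ((+ p) / q ℚ.+ (+ L) / 1)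
  m*q≤k*[p+L*q]⇒m≤k*[p/q+L] m k p q@(suc _) L m*q≤ =
    ℚ.toℚᵘ-cancel-≤ (ℚᵘ.≤-respʳ-≃ (ℚᵘ.≃-sym rhs≃) (ℚᵘ.≤-respˡ-≃ (ℚᵘ.≃-sym (toℚᵘ-+/ m 1)) m≤rhsᵘ))
    where
    open ≡-Reasoning
    rhs≃ : toℚᵘ ((+ k) / 1 ℚ.* ((+ p) / q ℚ.+ (+ L) / 1)) ℚᵘ.≃
           (+ k) ℚᵘ./ 1 ℚᵘ.* ((+ p) ℚᵘ./ q ℚᵘ.+ (+ L) ℚᵘ./ 1)
    rhs≃ = ℚᵘ.≃-trans (ℚ.toℚᵘ-homo-* ((+ k) / 1) ((+ p) / q ℚ.+ (+ L) / 1))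
      (ℚᵘ.*-cong (toℚᵘ-+/ k 1)
        (ℚᵘ.≃-trans (ℚ.toℚᵘ-homo-+ ((+ p) / q) ((+ L) / 1)) (ℚᵘ.+-cong (toℚᵘ-+/ p q) (toℚᵘ-+/ L 1))))
    -- The right-hand sides are ↧ and ↥ of the ℚᵘ sum and product exactly as _+_ and _*_ compute them.
    m*q≡ : + (m ℕ.* q) ≡ + m ℤ.* + (q ℕ.* 1 ℕ.+ 0)
    m*q≡ = begin
      + (m ℕ.* q)                ≡⟨ cong (λ d → + (m ℕ.* d)) (sym q*1+0≡q) ⟩
      + (m ℕ.* (q ℕ.* 1 ℕ.+ 0))  ≡⟨ ℤ.pos-* m _ ⟩
      + m ℤ.* + (q ℕ.* 1 ℕ.+ 0)  ∎
      where
      q*1+0≡q : q ℕ.* 1 ℕ.+ 0 ≡ q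
      q*1+0≡q = trans (ℕ.+-identityʳ (q ℕ.* 1)) (ℕ.*-identityʳ q)
    k*[p+L*q]≡ : + (k ℕ.* (p ℕ.+ L ℕ.* q)) ≡ + k ℤ.* (+ p ℤ.* + 1 ℤ.+ + L ℤ.* + q) ℤ.* + 1
    k*[p+L*q]≡ = begin
      + (k ℕ.* (p ℕ.+ L ℕ.* q))                ≡⟨ ℤ.pos-* k _ ⟩
      + k ℤ.* + (p ℕ.+ L ℕ.* q)                ≡⟨ cong (+ k ℤ.*_) (ℤ.pos-+ p _) ⟩
      + k ℤ.* (+ p ℤ.+ + (L ℕ.* q))            ≡⟨ cong (λ z → + k ℤ.* (z ℤ.+ + (L ℕ.* q))) (sym (ℤ.*-identityʳ (+ p))) ⟩
      + k ℤ.* (+ p ℤ.* + 1 ℤ.+ + (L ℕ.* q))    ≡⟨ cong (λ z → + k ℤ.* (+ p ℤ.* + 1 ℤ.+ z)) (ℤ.pos-* L q) ⟩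
      + k ℤ.* (+ p ℤ.* + 1 ℤ.+ + L ℤ.* + q)    ≡⟨ sym (ℤ.*-identityʳ _) ⟩
      + k ℤ.* (+ p ℤ.* + 1 ℤ.+ + L ℤ.* + q) ℤ.* + 1 ∎
    m≤rhsᵘ : (+ m) ℚᵘ./ 1 ℚᵘ.≤ (+ k) ℚᵘ./ 1 ℚᵘ.* ((+ p) ℚᵘ./ q ℚᵘ.+ (+ L) ℚᵘ./ 1)
    m≤rhsᵘ = ℚᵘ.*≤* (subst₂ ℤ._≤_ m*q≡ k*[p+L*q]≡ (ℤ.+≤+ m*q≤))

  maxSubgraphDensity-fraction : ∀ {n} {G : Graph n} {ρ} → IsMaxSubgraphDensity G ρ →
                                ∃[ p ] ∃[ q-1 ] ρ ≡ (+ p) / suc q-1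
  maxSubgraphDensity-fraction {ρ = mkℚ (+ p) q-1 coprime} _ = p , q-1 , sym (ℚ.normalize-coprime coprime)
  maxSubgraphDensity-fraction {ρ = mkℚ -[1+ _ ] _ _} ((H , k , _ , density≡ρ) , _) =
    ⊥-elim (ℚ.nonNeg≢neg _ _ {{ℚ.normalize-nonNeg (numE H) (suc k)}} density≡ρ)

  maxSubgraphDensity⇒DensityBoundedBy : ∀ {n} {G : Graph n} p q .{{_ : NonZero q}} →
    IsMaxSubgraphDensity G ((+ p) / q) → DensityBoundedBy G p q
  maxSubgraphDensity⇒DensityBoundedBy p q (_ , density≤ρ) H 0<|H| with numV H in |H|≡
  ... | suc k = a/k≤b/l⇒a*l≤b*k (numE H) (suc k) p q (density≤ρ H k |H|≡)

open import Data.Nat using (ℕ; suc; _≤_)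
open import Data.Nat.Logarithm using (⌊log₂_⌋)
open import Data.Fin using (Fin)
open import Data.Bool using (Bool; true)
open import Data.Product using (∃-syntax; _,_)
open import Data.Integer using (+_)
open import Data.Rational using (ℚ; _/_; _+_; _*_) renaming (_≤_ to _≤ℚ_)
open import Relation.Binary.PropositionalEquality using (_≡_; sym; subst)
open Fractions using (maxSubgraphDensity-fraction; maxSubgraphDensity⇒DensityBoundedBy; m*q≤k*[p+L*q]⇒m≤k*[p/q+L])
open OutdegreeBound using (maxOutdeg*q≤512*[p+⌊log₂n⌋*q])

corollary4 :
    ∃[ C ] (∀ (n : ℕ) → 2 ≤ n → (G : Graph n) (ρ : ℚ) → IsMaxSubgraphDensity G ρ →
      (D : Fin n → Fin n → Bool) → IsOrientation G D →
      (∀ u v → D u v ≡ true → LeOnePlusInvLn n (outdeg D u) (outdeg D v)) →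
      ((+ maxOutdeg D) / 1) ≤ℚ ((+ C) / 1) * (ρ + (+ ⌊log₂ n ⌋) / 1))
corollary4 = 512 , λ n 2≤n G ρ ρ-max D orient balanced →
  let p , q-1 , ρ≡p/q = maxSubgraphDensity-fraction ρ-max
      sparse = maxSubgraphDensity⇒DensityBoundedBy p (suc q-1) (subst (IsMaxSubgraphDensity G) ρ≡p/q ρ-max)
  in subst (λ r → (+ maxOutdeg D) / 1 ≤ℚ (+ 512) / 1 * (r + (+ ⌊log₂ n ⌋) / 1)) (sym ρ≡p/q)
       (m*q≤k*[p+L*q]⇒m≤k*[p/q+L] (maxOutdeg D) 512 p (suc q-1) ⌊log₂ n ⌋
         (maxOutdeg*q≤512*[p+⌊log₂n⌋*q] 2≤n G p (suc q-1) sparse D orient balanced))
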